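{- Let $n\ge 3$ and let $f$ be an $(n-2)$-eigenfunction of the Star graph $S_n$. Then $E(f)=\{\sum_{i=1}^n m_{i,\pi(i)}(f): \pi\in Sym_n\}$.
   Context: For $n\ge 3$, the Star graph $S_n$ is the Cayley graph on $Sym_n$ with generating set $\{(1\,i): 2\le i\le n\}$. A $\lambda$-eigenfunction is a nonzero $f:Sym_n\to\mathbb{R}$ with $\lambda f(x)=\sum_{y\in N(x)}f(y)$ for all $x$. $E(f)=\{f(x): x\in Sym_n\}$ is the set of values of $f$. For $u\in\{1,\ldots,n\}$ and $v\ne w$ in $\{2,\ldots,n\}$, $f_u^{v,w}(\pi)$ equals $1$ if $\pi(v)=u$, $-1$ if $\pi(w)=u$, and $0$ otherwise. It is known that the functions $f_i^{2,j}$, $i\in\{2,\ldots,n\}$, $j\in\{3,\ldots,n\}$, form a basis of the $(n-2)$-eigenspace of $S_n$; so $f=\sum_{i,j}\mu_i^j(f) f_i^{2,j}$ for unique reals $\mu_i^j(f)$. Define $M(f)=(m_{i,j}(f))$ by $m_{i,j}(f)=-\mu_i^j(f)$ if $i>1,j>2$; $m_{i,2}(f)=\sum_{s=3}^n\mu_i^s(f)$ if $i>1$; and $m_{i,j}(f)=0$ if $i=1$ or $j=1$. -}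

module Defs where

open import Level using (Level)
open import Algebra.Bundles using (CommutativeRing)
open import Data.Nat as ℕ using (ℕ; zero; suc; _≤_; _<_; _∸_; s≤s; z≤n)
open import Data.Nat.Properties using (≤-trans)
open import Data.Fin using (Fin; toℕ; fromℕ<; _≟_)
open import Data.Fin.Permutation using (Permutation′; _⟨$⟩ʳ_; _∘ₚ_; transpose)
open import Data.Bool using (Bool; true; false; if_then_else_)
open import Data.Product using (∃; _×_)
open import Relation.Nullary using (¬_; does)

-- Convention: the point k ∈ {1,…,n} is represented by the index i : Fin n
-- with toℕ i = k - 1.  Sym_n is represented by Permutation′ n.

pt1 : ∀ {n} → 3 ≤ n → Fin n
pt1 h = fromℕ< (≤-trans (s≤s z≤n) h)

pt2 : ∀ {n} → 3 ≤ n → Fin n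
pt2 h = fromℕ< (≤-trans (s≤s (s≤s z≤n)) h)

-- "the point represented by i is ≥ k+1", i.e. toℕ i ≥ k
atLeast : ∀ {n} → ℕ → Fin n → Bool
atLeast k i = does (k ℕ.≤? toℕ i)

module _ {c ℓ : Level} (R : CommutativeRing c ℓ) where
  open CommutativeRing R

  ⟦_⟧ : ℕ → Carrier
  ⟦ zero ⟧  = 0#
  ⟦ suc m ⟧ = 1# + ⟦ m ⟧

  ∑ : ∀ {n} → (Fin n → Carrier) → Carrier
  ∑ {zero}  g = 0#
  ∑ {suc n} g = g Fin.zero + ∑ (λ i → g (Fin.suc i))

  ∑≥ : ∀ {n} → ℕ → (Fin n → Carrier) → Carrier
  ∑≥ k g = ∑ (λ i → if atLeast k i then g i else 0#)

  δ : ∀ {n} → Fin n → Fin n → Carrier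
  δ a b = if does (a ≟ b) then 1# else 0#

  -- Neighbours of x in the Star graph: x ∘ (1 i), i = 2,…,n  (right Cayley graph).
  -- λ-eigenfunction of S_n: nonzero f with λ f(x) = ∑_{y ∈ N(x)} f(y).
  IsEigenfunction : ∀ {n} → 3 ≤ n → Carrier → (Permutation′ n → Carrier) → Set ℓ
  IsEigenfunction {n} h λ₀ f =
    (∃ λ x → ¬ (f x ≈ 0#)) ×
    (∀ x → λ₀ * f x ≈ ∑≥ 1 (λ i → f (transpose (pt1 h) i ∘ₚ x)))

  fuvw : ∀ {n} → Fin n → Fin n → Fin n → Permutation′ n → Carrier
  fuvw u v w π = δ (π ⟨$⟩ʳ v) u - δ (π ⟨$⟩ʳ w) u

  -- f = ∑_{i ∈ {2..n}, j ∈ {3..n}} μ_i^j f_i^{2,j}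
  Represents : ∀ {n} → 3 ≤ n → (Fin n → Fin n → Carrier) → (Permutation′ n → Carrier) → Set ℓ
  Represents h μ f =
    ∀ x → f x ≈ ∑≥ 1 (λ i → ∑≥ 2 (λ j → μ i j * fuvw i (pt2 h) j x))

  Mmat : ∀ {n} → (Fin n → Fin n → Carrier) → Fin n → Fin n → Carrier
  Mmat μ i j =
    if atLeast 1 i
    then (if atLeast 2 j then - μ i j
          else if atLeast 1 j then ∑≥ 2 (λ s → μ i s)
          else 0#)
    else 0#

{-# OPTIONS --safe #-}
-- Extend μ by zero outside i ≥ 2, j ≥ 3 to a matrix μ̃.  Since f_i^{2,j}(x) = [x(2) = i] − [x(j) = i],
-- the expansion gives f(x) = ∑_j μ̃(x(2), j) − ∑_j μ̃(x(j), j).  Column 2 of M holds the row sums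
-- of μ̃ and column j ≥ 3 holds −μ̃(·, j), so ∑_j m_{x(j), j} is the same expression; reindexing by
-- x turns it into ∑_i m_{i, x⁻¹(i)}.  Thus f(x) is the diagonal sum of M along x⁻¹, and every π
-- arises from x = π⁻¹.
module Submission where

open import Defs
open import Level using (Level)
open import Algebra.Bundles using (CommutativeRing)
open import Data.Nat using (ℕ; _≤_; _∸_; zero; suc; s≤s)
open import Data.Fin using (Fin; zero; suc; punchIn)
open import Data.Fin.Permutation using (Permutation′; _⟨$⟩ʳ_; _⟨$⟩ˡ_; flip; inverseˡ)
open import Data.Product using (∃; _×_; _,_)
open import Data.Bool using (Bool; true; false; if_then_else_)
open import Function using (_∘_)
open import Relation.Nullary.Decidable using (dec-true; dec-false)
open import Relation.Binary.PropositionalEquality as ≡ using (_≡_; _≢_)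
import Data.Fin.Properties as Fin

module _ {c ℓ : Level} (R : CommutativeRing c ℓ) where
  open CommutativeRing R hiding (zero)
  open import Algebra.Properties.Semiring.Sum semiring
  open import Algebra.Properties.Ring ring using (x[y-z]≈xy-xz)
  open import Algebra.Properties.AbelianGroup +-abelianGroup using (ε⁻¹≈ε; ⁻¹-∙-comm)
  open import Relation.Binary.Reasoning.Setoid setoid

  ∑≡sum : ∀ {n} (g : Fin n → Carrier) → ∑ R g ≡ sum g
  ∑≡sum {zero}  g = ≡.refl
  ∑≡sum {suc n} g = ≡.cong (g zero +_) (∑≡sum (g ∘ suc))

  sum-neg : ∀ {n} (g : Fin n → Carrier) → sum (λ i → - g i) ≈ - sum g
  sum-neg {zero}  g = sym ε⁻¹≈ε
  sum-neg {suc n} g = trans (+-congˡ (sum-neg (g ∘ suc))) (⁻¹-∙-comm _ _)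

  sum-distrib-− : ∀ {n} (g h : Fin n → Carrier) → sum (λ i → g i - h i) ≈ sum g - sum h
  sum-distrib-− g h = trans (∑-distrib-+ g (λ i → - h i)) (+-congˡ (sum-neg h))

  when : Bool → Carrier → Carrier
  when b u = if b then u else 0#

  when-cong : ∀ b {u v} → u ≈ v → when b u ≈ when b v
  when-cong true  u≈v = u≈v
  when-cong false _   = refl

  when-*ʳ : ∀ b u k → when b (u * k) ≈ when b u * k
  when-*ʳ true  u k = refl
  when-*ʳ false u k = sym (zeroˡ k)

  when-sum : ∀ {n} b (g : Fin n → Carrier) → when b (sum g) ≈ sum (λ j → when b (g j))
  when-sum         true  g = refl
  when-sum {n = n} false g = sym (sum-replicate-zero n)

  ∑≥≡sum : ∀ {n} k (g : Fin n → Carrier) → ∑≥ R k g ≡ sum (λ i → when (atLeast k i) (g i))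
  ∑≥≡sum k g = ∑≡sum (λ i → when (atLeast k i) (g i))

  δ-refl : ∀ {n} (a : Fin n) → δ R a a ≡ 1#
  δ-refl a = ≡.cong (if_then 1# else 0#) (dec-true (a Fin.≟ a) ≡.refl)

  δ-≢ : ∀ {n} {a b : Fin n} → a ≢ b → δ R a b ≡ 0#
  δ-≢ {a = a} {b} a≢b = ≡.cong (if_then 1# else 0#) (dec-false (a Fin.≟ b) a≢b)

  sum-*δ : ∀ {n} (g : Fin n → Carrier) b → sum (λ i → g i * δ R b i) ≈ g b
  sum-*δ {suc n} g b = begin
    sum (λ i → g i * δ R b i)
      ≈⟨ sum-remove {i = b} (λ i → g i * δ R b i) ⟩
    g b * δ R b b + sum (λ k → g (punchIn b k) * δ R b (punchIn b k))
      ≈⟨ +-cong onDiagonal offDiagonal ⟩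
    g b + 0#
      ≈⟨ +-identityʳ (g b) ⟩
    g b ∎
    where
    onDiagonal : g b * δ R b b ≈ g b
    onDiagonal = trans (reflexive (≡.cong (g b *_) (δ-refl b))) (*-identityʳ (g b))
    offDiagonal : sum (λ k → g (punchIn b k) * δ R b (punchIn b k)) ≈ 0#
    offDiagonal = trans
      (sum-cong-≋ (λ k → trans (reflexive (≡.cong (g (punchIn b k) *_) (δ-≢ (Fin.punchInᵢ≢i b k ∘ ≡.sym))))
                               (zeroʳ (g (punchIn b k)))))
      (sum-replicate-zero n)

  sum-permutedDiagonal : ∀ {n} (A : Fin n → Fin n → Carrier) (π : Permutation′ n) →
                         sum (λ i → A i (π ⟨$⟩ˡ i)) ≈ sum (λ j → A (π ⟨$⟩ʳ j) j)
  sum-permutedDiagonal A π = trans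
    (sum-permute (λ i → A i (π ⟨$⟩ˡ i)) π)
    (reflexive (sum-cong-≗ (λ j → ≡.cong (A (π ⟨$⟩ʳ j)) (inverseˡ π))))

  sum-*δ-difference : ∀ {n} (A : Fin n → Fin n → Carrier) b (σ : Fin n → Fin n) →
                      sum (λ i → sum (λ j → A i j * (δ R b i - δ R (σ j) i)))
                      ≈ sum (A b) - sum (λ j → A (σ j) j)
  sum-*δ-difference A b σ = begin
    sum (λ i → sum (λ j → A i j * (δ R b i - δ R (σ j) i)))
      ≈⟨ sum-cong-≋ (λ i → trans (sum-cong-≋ (λ j → x[y-z]≈xy-xz (A i j) (δ R b i) (δ R (σ j) i)))
                                 (sum-distrib-− (λ j → A i j * δ R b i) (λ j → A i j * δ R (σ j) i))) ⟩
    sum (λ i → sum (λ j → A i j * δ R b i) - sum (λ j → A i j * δ R (σ j) i))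
      ≈⟨ sum-distrib-− (λ i → sum (λ j → A i j * δ R b i)) (λ i → sum (λ j → A i j * δ R (σ j) i)) ⟩
    sum (λ i → sum (λ j → A i j * δ R b i)) - sum (λ i → sum (λ j → A i j * δ R (σ j) i))
      ≈⟨ +-cong rowPart (-‿cong diagonalPart) ⟩
    sum (A b) - sum (λ j → A (σ j) j)
      ∎
    where
    rowPart : sum (λ i → sum (λ j → A i j * δ R b i)) ≈ sum (A b)
    rowPart = trans (sum-cong-≋ (λ i → sym (*-distribʳ-sum (δ R b i) (A i))))
                    (sum-*δ (λ i → sum (A i)) b)
    diagonalPart : sum (λ i → sum (λ j → A i j * δ R (σ j) i)) ≈ sum (λ j → A (σ j) j)
    diagonalPart = trans (∑-comm (λ i j → A i j * δ R (σ j) i))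
                         (sum-cong-≋ (λ j → sum-*δ (λ i → A i j) (σ j)))

  restrict : ∀ {n} → ℕ → ℕ → (Fin n → Fin n → Carrier) → Fin n → Fin n → Carrier
  restrict k l A i j = when (atLeast k i) (when (atLeast l j) (A i j))

  ∑≥∑≥-restrict : ∀ {n} k l (A C : Fin n → Fin n → Carrier) →
            ∑≥ R k (λ i → ∑≥ R l (λ j → A i j * C i j))
            ≈ sum (λ i → sum (λ j → restrict k l A i j * C i j))
  ∑≥∑≥-restrict k l A C = begin
    ∑≥ R k (λ i → ∑≥ R l (λ j → A i j * C i j))
      ≡⟨ ≡.trans (∑≥≡sum k (λ i → ∑≥ R l (λ j → A i j * C i j)))
                 (sum-cong-≗ (λ i → ≡.cong (when (atLeast k i)) (∑≥≡sum l (λ j → A i j * C i j)))) ⟩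
    sum (λ i → when (atLeast k i) (sum (λ j → when (atLeast l j) (A i j * C i j))))
      ≈⟨ sum-cong-≋ (λ i → trans (when-sum (atLeast k i) (λ j → when (atLeast l j) (A i j * C i j)))
                                 (sum-cong-≋ (λ j → guards-*ʳ (atLeast k i) (atLeast l j) (A i j) (C i j)))) ⟩
    sum (λ i → sum (λ j → restrict k l A i j * C i j))
      ∎
    where
    guards-*ʳ : ∀ a b u v → when a (when b (u * v)) ≈ when a (when b u) * v
    guards-*ʳ a b u v = trans (when-cong a (when-*ʳ b u v)) (when-*ʳ a (when b u) v)

  represented-value : ∀ {n} k l (μ : Fin n → Fin n → Carrier) v (x : Permutation′ n) →
                      ∑≥ R k (λ i → ∑≥ R l (λ j → μ i j * fuvw R i v j x))
                      ≈ sum (restrict k l μ (x ⟨$⟩ʳ v)) - sum (λ j → restrict k l μ (x ⟨$⟩ʳ j) j)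
  represented-value k l μ v x = trans
    (∑≥∑≥-restrict k l μ (λ i j → fuvw R i v j x))
    (sum-*δ-difference (restrict k l μ) (x ⟨$⟩ʳ v) (x ⟨$⟩ʳ_))

  Mmat-decomposition : ∀ {n} (μ : Fin (suc (suc n)) → Fin (suc (suc n)) → Carrier) i j →
                       Mmat R μ i j ≈ sum (restrict 1 2 μ i) * δ R (suc zero) j - restrict 1 2 μ i j
  Mmat-decomposition {n} μ zero j = sym (begin
    sum {suc (suc n)} (λ _ → 0#) * δ R (suc zero) j - 0#
      ≈⟨ +-cong (trans (*-congʳ (sum-replicate-zero (suc (suc n)))) (zeroˡ _)) ε⁻¹≈ε ⟩
    0# + 0#
      ≈⟨ +-identityʳ 0# ⟩
    0# ∎)
  Mmat-decomposition μ (suc i) zero = sym (trans (+-cong (zeroʳ _) ε⁻¹≈ε) (+-identityʳ 0#))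
  Mmat-decomposition μ (suc i) (suc zero) = sym (begin
    sum (restrict 1 2 μ (suc i)) * 1# - 0#  ≈⟨ +-cong (*-identityʳ _) ε⁻¹≈ε ⟩
    sum (restrict 1 2 μ (suc i)) + 0#       ≈⟨ +-identityʳ _ ⟩
    sum (restrict 1 2 μ (suc i))            ≡⟨ ∑≥≡sum 2 (μ (suc i)) ⟨
    ∑≥ R 2 (μ (suc i))                      ∎)
  Mmat-decomposition μ (suc i) (suc (suc j)) = sym (trans (+-congʳ (zeroʳ _)) (+-identityˡ _))

  diagonal-value : ∀ {n} (μ : Fin (suc (suc n)) → Fin (suc (suc n)) → Carrier) x →
                   sum (λ i → Mmat R μ i (x ⟨$⟩ˡ i))
                   ≈ sum (restrict 1 2 μ (x ⟨$⟩ʳ suc zero)) - sum (λ j → restrict 1 2 μ (x ⟨$⟩ʳ j) j)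
  diagonal-value μ x = begin
    sum (λ i → Mmat R μ i (x ⟨$⟩ˡ i))
      ≈⟨ sum-permutedDiagonal (Mmat R μ) x ⟩
    sum (λ j → Mmat R μ (σ j) j)
      ≈⟨ sum-cong-≋ (λ j → Mmat-decomposition μ (σ j) j) ⟩
    sum (λ j → rowTotal (σ j) * δ R (suc zero) j - μ̃ (σ j) j)
      ≈⟨ sum-distrib-− (λ j → rowTotal (σ j) * δ R (suc zero) j) (λ j → μ̃ (σ j) j) ⟩
    sum (λ j → rowTotal (σ j) * δ R (suc zero) j) - sum (λ j → μ̃ (σ j) j)
      ≈⟨ +-congʳ (sum-*δ (rowTotal ∘ σ) (suc zero)) ⟩
    rowTotal (σ (suc zero)) - sum (λ j → μ̃ (σ j) j)
      ∎
    where
    σ : Fin _ → Fin _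
    σ = x ⟨$⟩ʳ_
    μ̃ : Fin _ → Fin _ → Carrier
    μ̃ = restrict 1 2 μ
    rowTotal : Fin _ → Carrier
    rowTotal = sum ∘ μ̃

lemma4 : ∀ {c ℓ : Level} (R : CommutativeRing c ℓ) →
    let open CommutativeRing R in
    (n : ℕ) (h : 3 ≤ n) (f : Permutation′ n → Carrier) →
    IsEigenfunction R h (⟦_⟧ R (n ∸ 2)) f →
    (μ : Fin n → Fin n → Carrier) → Represents R h μ f →
    (∀ x → ∃ λ (π : Permutation′ n) → f x ≈ ∑ R (λ i → Mmat R μ i (π ⟨$⟩ʳ i))) ×
    (∀ (π : Permutation′ n) → ∃ λ x → f x ≈ ∑ R (λ i → Mmat R μ i (π ⟨$⟩ʳ i)))
-- Matching on h makes pt2 h reduce to suc zero.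
lemma4 R _ (s≤s (s≤s (s≤s _))) f _ μ represents =
  (λ x → flip x , f≈diagonal x) , (λ π → flip π , f≈diagonal (flip π))
  where
  open CommutativeRing R using (_≈_; trans; sym; reflexive)
  f≈diagonal : ∀ x → f x ≈ ∑ R (λ i → Mmat R μ i (x ⟨$⟩ˡ i))
  f≈diagonal x =
    trans (represents x) (
    trans (represented-value R 1 2 μ (suc zero) x) (
    trans (sym (diagonal-value R μ x))
          (reflexive (≡.sym (∑≡sum R (λ i → Mmat R μ i (x ⟨$⟩ˡ i)))))))
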